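{- Let $\rho$ be a graph invariant that is maxing and monotone increasing. Let $G=H_1\cup H_2\cup\dots\cup H_k$ be a graph that is the union of pairwise vertex-disjoint subgraphs $H_1,\dots,H_k$, and let $s\geq 1$ be an integer such that $\rho(H_i)=\rho(G)$ if and only if $1\leq i\leq s$. Then $vs_{\rho}(G)=\sum_{i=1}^{s} vs_{\rho}(H_i)$.
   Context: All graphs are finite and simple. A graph invariant is a function $\rho$ from the class of finite simple graphs to $\mathbb{R}^+\cup\{\infty\}$. It is monotone increasing if $H\subseteq G$ implies $\rho(H)\leq\rho(G)$, and monotone decreasing if $H\subseteq G$ implies $\rho(H)\geq\rho(G)$. It is maxing if $\rho(H_1\cup H_2)=\max\{\rho(H_1),\rho(H_2)\}$ for disjoint graphs $H_1,H_2$. For an invariant $\rho$, the $\rho$-vertex stability number $vs_{\rho}(G)$ is the minimum number of vertices of $G$ whose removal results in a graph $H\subseteq G$ with $\rho(H)\neq\rho(G)$ or with $E(H)=\emptyset$. -}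

module Defs where

open import Level using (0ℓ)
open import Data.Nat using (ℕ; zero; suc; _+_; _≤_)
open import Data.Fin using (Fin; splitAt)
open import Data.Bool using (Bool; true; false)
open import Data.Sum using (_⊎_; inj₁; inj₂)
open import Data.Product using (Σ; ∃; _×_; _,_)
open import Relation.Binary.PropositionalEquality using (_≡_; refl)
open import Relation.Binary.Bundles using (TotalOrder)
open import Relation.Nullary using (¬_)

record Graph : Set where
  field
    n      : ℕ
    adj    : Fin n → Fin n → Bool
    sym    : ∀ u v → adj u v ≡ adj v u
    irrefl : ∀ v → adj v v ≡ false
open Graph public

Injective : ∀ {a b} → (Fin a → Fin b) → Set
Injective f = ∀ {u v} → f u ≡ f v → u ≡ v

-- H ⊆ G : H is (an isomorphic copy of) a subgraph of G, i.e. there is an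
-- injective, edge-preserving map V(H) → V(G).
_⊆_ : Graph → Graph → Set
H ⊆ G = Σ (Fin (n H) → Fin (n G)) λ f →
          Injective f × (∀ u v → adj H u v ≡ true → adj G (f u) (f v) ≡ true)

Edgeless : Graph → Set
Edgeless H = ∀ u v → adj H u v ≡ false

⊕adj : ∀ {a b} → (Fin a → Fin a → Bool) → (Fin b → Fin b → Bool)
     → Fin (a + b) → Fin (a + b) → Bool
⊕adj {a} p q u v with splitAt a u | splitAt a v
... | inj₁ x | inj₁ y = p x y
... | inj₂ x | inj₂ y = q x y
... | inj₁ _ | inj₂ _ = false
... | inj₂ _ | inj₁ _ = false

⊕sym : ∀ {a b} (p : Fin a → Fin a → Bool) (q : Fin b → Fin b → Bool)
     → (∀ u v → p u v ≡ p v u) → (∀ u v → q u v ≡ q v u)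
     → ∀ u v → ⊕adj p q u v ≡ ⊕adj p q v u
⊕sym {a} p q sp sq u v with splitAt a u | splitAt a v
... | inj₁ x | inj₁ y = sp x y
... | inj₂ x | inj₂ y = sq x y
... | inj₁ _ | inj₂ _ = refl
... | inj₂ _ | inj₁ _ = refl

⊕irr : ∀ {a b} (p : Fin a → Fin a → Bool) (q : Fin b → Fin b → Bool)
     → (∀ v → p v v ≡ false) → (∀ v → q v v ≡ false)
     → ∀ v → ⊕adj p q v v ≡ false
⊕irr {a} p q ip iq v with splitAt a v
... | inj₁ x = ip x
... | inj₂ x = iq x

_⊕_ : Graph → Graph → Graph
G₁ ⊕ G₂ = record
  { n      = n G₁ + n G₂
  ; adj    = ⊕adj (adj G₁) (adj G₂)
  ; sym    = ⊕sym (adj G₁) (adj G₂) (sym G₁) (sym G₂)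
  ; irrefl = ⊕irr (adj G₁) (adj G₂) (irrefl G₁) (irrefl G₂)
  }

module _ (T : TotalOrder 0ℓ 0ℓ 0ℓ) where
  open TotalOrder T renaming (Carrier to Val; _≤_ to _≼_)

  MonotoneIncreasing : (Graph → Val) → Set
  MonotoneIncreasing ρ = ∀ H G → H ⊆ G → ρ H ≼ ρ G

  -- ρ(H₁ ∪ H₂) = max{ρ(H₁), ρ(H₂)} for disjoint H₁, H₂
  -- (max in the total order, spelled out).
  Maxing : (Graph → Val) → Set
  Maxing ρ = ∀ H₁ H₂ →
      (ρ H₂ ≼ ρ H₁ → ρ (H₁ ⊕ H₂) ≈ ρ H₁)
    × (ρ H₁ ≼ ρ H₂ → ρ (H₁ ⊕ H₂) ≈ ρ H₂)

  -- H is (an isomorphic copy of) the graph obtained from G by removing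
  -- exactly k vertices: an induced embedding of H into G missing k vertices.
  RemovalOf : Graph → ℕ → Graph → Set
  RemovalOf G k H = (n H + k ≡ n G) × (Σ (Fin (n H) → Fin (n G)) λ f →
                      Injective f × (∀ u v → adj H u v ≡ adj G (f (u)) (f v)))

  Destroys : (Graph → Val) → Graph → ℕ → Set
  Destroys ρ G k = ∃ λ H → RemovalOf G k H × ((¬ (ρ H ≈ ρ G)) ⊎ Edgeless H)

  IsVS : (Graph → Val) → Graph → ℕ → Set
  IsVS ρ G m = Destroys ρ G m × (∀ k → Destroys ρ G k → m ≤ k)

record DisjointUnion {k : ℕ} (G : Graph) (H : Fin k → Graph) : Set where
  field
    emb       : ∀ i → Fin (n (H i)) → Fin (n G)
    emb-inj   : ∀ i → Injective (emb i)
    emb-edge  : ∀ i u v → adj (H i) u v ≡ true → adj G (emb i u) (emb i v) ≡ true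
    disjoint  : ∀ i j u v → emb i u ≡ emb j v → i ≡ j
    cover-V   : ∀ x → Σ (Fin k) λ i → Σ (Fin (n (H i))) λ u → emb i u ≡ x
    cover-E   : ∀ x y → adj G x y ≡ true →
                Σ (Fin k) λ i → Σ (Fin (n (H i))) λ u → Σ (Fin (n (H i))) λ v →
                  (emb i u ≡ x) × (emb i v ≡ y) × (adj (H i) u v ≡ true)

∑ : ∀ {s} → (Fin s → ℕ) → ℕ
∑ {zero}  f = 0
∑ {suc s} f = f Fin.zero + ∑ (λ i → f (Fin.suc i))

module Submission where

-- Upper bound: destroy each of the first s components optimally and keep the
-- others.  The remaining graph is the disjoint union ⨁ P of the pieces, a
-- removal of ∑ m vertices (lemma assemble).  Since ρ of a disjoint union is
-- the value of one of its pieces, and an edgeless piece has ρ below any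
-- non-empty graph, ⨁ P is either edgeless or has ρ ≠ ρ(G) (⨁-destroys).
--
-- Lower bound: a destroying removal H' of G restricts to removals Qᵢ of the
-- components (module Restriction) with ∑ (removed from Hᵢ) ≤ |removed|.
-- Each Qᵢ ⊆ H' ⊆ G destroys Hᵢ for i ≤ s (lift-destroy), so mᵢ is at most
-- the number of vertices removed from Hᵢ.

open import Defs
open import Level using (0ℓ)
open import Function using (_∘_)
open import Data.Nat using (ℕ; zero; suc; _+_; _≤_; _∸_; z≤n; s≤s)
import Data.Nat.Properties as ℕP
open import Data.Fin using (Fin; _↑ˡ_; _↑ʳ_; splitAt; join; _≟_)
import Data.Fin as F
open import Data.Fin.Properties
  using (splitAt-↑ˡ; splitAt-↑ʳ; join-splitAt; injective⇒≤; cantor-schröder-bernstein; suc-injective; any?; all?; ¬∀⟶∃¬)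
open import Data.Bool using (Bool; true; false)
open import Data.Bool.Properties using (¬-not)
import Data.Bool.Properties as BoolP
open import Data.Sum using (_⊎_; inj₁; inj₂; [_,_]′)
open import Data.Product using (Σ; _×_; _,_; proj₁; proj₂)
open import Data.Empty using (⊥; ⊥-elim)
open import Relation.Binary.PropositionalEquality as Eq using (_≡_; refl; cong; cong₂; subst)
open import Relation.Binary.Bundles using (TotalOrder)
open import Relation.Nullary using (¬_; yes; no; does; Dec)
import Algebra.Properties.CommutativeSemigroup as CommSemigroupProps

∑-cong : ∀ {s} {f g : Fin s → ℕ} → (∀ i → f i ≡ g i) → ∑ f ≡ ∑ g
∑-cong {zero}  f≡g = refl
∑-cong {suc s} f≡g = cong₂ _+_ (f≡g F.zero) (∑-cong (f≡g ∘ F.suc))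

∑-+ : ∀ {s} (f g : Fin s → ℕ) → ∑ (λ i → f i + g i) ≡ ∑ f + ∑ g
∑-+ {zero}  f g = refl
∑-+ {suc s} f g rewrite ∑-+ (f ∘ F.suc) (g ∘ F.suc) =
  CommSemigroupProps.interchange ℕP.+-commutativeSemigroup (f F.zero) (g F.zero) _ _

∑-mono : ∀ {s} {f g : Fin s → ℕ} → (∀ i → f i ≤ g i) → ∑ f ≤ ∑ g
∑-mono {zero}  f≤g = z≤n
∑-mono {suc s} f≤g = ℕP.+-mono-≤ (f≤g F.zero) (∑-mono (f≤g ∘ F.suc))

∑-zero : ∀ s → ∑ {s} (λ _ → 0) ≡ 0
∑-zero zero    = refl
∑-zero (suc s) = ∑-zero s

∑-split : ∀ s t (f : Fin (s + t) → ℕ) →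
          ∑ f ≡ ∑ (λ i → f (i ↑ˡ t)) + ∑ (λ j → f (s ↑ʳ j))
∑-split zero    t f = refl
∑-split (suc s) t f rewrite ∑-split s t (f ∘ F.suc) = Eq.sym (ℕP.+-assoc (f F.zero) _ _)

data Side (s t : ℕ) : Fin (s + t) → Set where
  left  : (i : Fin s) → Side s t (i ↑ˡ t)
  right : (j : Fin t) → Side s t (s ↑ʳ j)

side : ∀ s t (k : Fin (s + t)) → Side s t k
side zero    t k         = right k
side (suc s) t F.zero    = left F.zero
side (suc s) t (F.suc k) with side s t k
... | left i  = left (F.suc i)
... | right j = right j

true≢false : ∀ {b : Bool} → b ≡ true → b ≡ false → ⊥
true≢false refl ()

≢true⇒≡false : ∀ {b : Bool} → ¬ b ≡ true → b ≡ false
≢true⇒≡false = ¬-not {y = true}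

≡-from-true⇔ : ∀ {b c : Bool} → (b ≡ true → c ≡ true) → (c ≡ true → b ≡ true) → b ≡ c
≡-from-true⇔ {true}  {true}  _ _ = refl
≡-from-true⇔ {true}  {false} f _ = Eq.sym (f refl)
≡-from-true⇔ {false} {true}  _ g = g refl
≡-from-true⇔ {false} {false} _ _ = refl

edgeless? : ∀ X → Dec (Edgeless X)
edgeless? X = all? (λ u → all? (λ v → adj X u v BoolP.≟ false))

⊆-edgeless : ∀ {X Y} → X ⊆ Y → Edgeless Y → Edgeless X
⊆-edgeless (f , _ , f-edge) Y-edgeless u v =
  ≢true⇒≡false (λ e → true≢false (f-edge u v e) (Y-edgeless _ _))

vertex-of : ∀ X → ¬ Edgeless X → Fin (n X)
vertex-of X ¬edgeless = nonempty (n X) (λ empty → ¬edgeless (λ u → ⊥-elim (empty u)))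
  where
  nonempty : ∀ k → ¬ (Fin k → ⊥) → Fin k
  nonempty zero    ¬empty = ⊥-elim (¬empty (λ ()))
  nonempty (suc k) _      = F.zero

Discrete : ℕ → Graph
Discrete k = record { n = k ; adj = λ _ _ → false ; sym = λ _ _ → refl ; irrefl = λ _ → refl }

-- Induced subgraphs.  The vertices of X selected by p : V(X) → Bool are
-- enumerated in increasing order by enum p : Fin (count p) → V(X).

sucIf : Bool → ℕ → ℕ
sucIf true  c = suc c
sucIf false c = c

count : ∀ {m} → (Fin m → Bool) → ℕ
count {zero}  p = 0
count {suc m} p = sucIf (p F.zero) (count (p ∘ F.suc))

enumStep : ∀ {c m} (b : Bool) → (Fin c → Fin m) → Fin (sucIf b c) → Fin (suc m)
enumStep true  e F.zero    = F.zero
enumStep true  e (F.suc u) = F.suc (e u)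
enumStep false e u         = F.suc (e u)

enum : ∀ {m} (p : Fin m → Bool) → Fin (count p) → Fin m
enum {zero}  p ()
enum {suc m} p = enumStep (p F.zero) (enum (p ∘ F.suc))

count-≤ : ∀ {m} (p : Fin m → Bool) → count p ≤ m
count-≤ {zero}  p = z≤n
count-≤ {suc m} p = step (p F.zero) (count-≤ (p ∘ F.suc))
  where
  step : ∀ {c} b → c ≤ m → sucIf b c ≤ suc m
  step true  c≤m = s≤s c≤m
  step false c≤m = ℕP.m≤n⇒m≤1+n c≤m

enum-injective : ∀ {m} (p : Fin m → Bool) → Injective (enum p)
enum-injective {zero}  p {()}
enum-injective {suc m} p = step (p F.zero) (enum-injective (p ∘ F.suc))
  where
  step : ∀ {c} b {e : Fin c → Fin m} → Injective e → Injective (enumStep b e)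
  step true  e-inj {F.zero}  {F.zero}  _  = refl
  step true  e-inj {F.suc u} {F.suc v} eq = cong F.suc (e-inj (suc-injective eq))
  step false e-inj                     eq = e-inj (suc-injective eq)

enum-selected : ∀ {m} (p : Fin m → Bool) u → p (enum p u) ≡ true
enum-selected {zero}  p ()
enum-selected {suc m} p = step (p F.zero) refl
  where
  step : ∀ b → p F.zero ≡ b → ∀ u → p (enumStep b (enum (p ∘ F.suc)) u) ≡ true
  step true  p0 F.zero    = p0
  step true  p0 (F.suc u) = enum-selected (p ∘ F.suc) u
  step false p0 u         = enum-selected (p ∘ F.suc) u

enum-surjective : ∀ {m} (p : Fin m → Bool) x → p x ≡ true → Σ (Fin (count p)) λ u → enum p u ≡ x
enum-surjective {suc m} p = step (p F.zero) refl
  where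
  step : ∀ b → p F.zero ≡ b → ∀ x → p x ≡ true →
         Σ (Fin (sucIf b (count (p ∘ F.suc)))) λ u → enumStep b (enum (p ∘ F.suc)) u ≡ x
  step true  p0 F.zero    _  = F.zero , refl
  step false p0 F.zero    px = ⊥-elim (true≢false px p0)
  step true  p0 (F.suc x) px with enum-surjective (p ∘ F.suc) x px
  ... | u , eu = F.suc u , cong F.suc eu
  step false p0 (F.suc x) px with enum-surjective (p ∘ F.suc) x px
  ... | u , eu = u , cong F.suc eu

Induced : (X : Graph) → (Fin (n X) → Bool) → Graph
Induced X p = record
  { n      = count p
  ; adj    = λ u v → adj X (enum p u) (enum p v)
  ; sym    = λ u v → sym X (enum p u) (enum p v)
  ; irrefl = λ u → irrefl X (enum p u)
  }

-- Iterated disjoint union ⨁ P = P 0 ⊕ (P 1 ⊕ (… ⊕ Discrete 0)).  A vertex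
-- of ⨁ P is ι P i u for a unique component i and vertex u of P i; maps out
-- of ⨁ P are built componentwise by copair.

⨁ : ∀ {K} → (Fin K → Graph) → Graph
⨁ {zero}  P = Discrete 0
⨁ {suc K} P = P F.zero ⊕ ⨁ (P ∘ F.suc)

sizes : ∀ {K} → (Fin K → Graph) → Fin K → ℕ
sizes P i = n (P i)

⨁-size : ∀ {K} (P : Fin K → Graph) → n (⨁ P) ≡ ∑ (sizes P)
⨁-size {zero}  P = refl
⨁-size {suc K} P = cong (n (P F.zero) +_) (⨁-size (P ∘ F.suc))

ι : ∀ {K} (P : Fin K → Graph) (i : Fin K) → Fin (n (P i)) → Fin (n (⨁ P))
ι {suc K} P F.zero    u = u ↑ˡ _
ι {suc K} P (F.suc i) u = n (P F.zero) ↑ʳ ι (P ∘ F.suc) i u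

copair : ∀ {K} (P : Fin K → Graph) {X : Set} → (∀ i → Fin (n (P i)) → X) → Fin (n (⨁ P)) → X
copair {zero}  P g ()
copair {suc K} P g x =
  [ g F.zero , copair (P ∘ F.suc) (g ∘ F.suc) ]′ (splitAt (n (P F.zero)) x)

copair-ι : ∀ {K} (P : Fin K → Graph) {X : Set} (g : ∀ i → Fin (n (P i)) → X) i u →
           copair P g (ι P i u) ≡ g i u
copair-ι {suc K} P g F.zero u
  rewrite splitAt-↑ˡ (n (P F.zero)) u (n (⨁ (P ∘ F.suc))) = refl
copair-ι {suc K} P g (F.suc i) u
  rewrite splitAt-↑ʳ (n (P F.zero)) (n (⨁ (P ∘ F.suc))) (ι (P ∘ F.suc) i u) =
  copair-ι (P ∘ F.suc) (g ∘ F.suc) i u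

locate : ∀ {K} (P : Fin K → Graph) x → Σ (Fin K) λ i → Σ (Fin (n (P i))) λ u → ι P i u ≡ x
locate {zero} P ()
locate {suc K} P x with splitAt (n (P F.zero)) x in split≡
... | inj₁ u = F.zero , u , rejoin
  where
  rejoin : u ↑ˡ n (⨁ (P ∘ F.suc)) ≡ x
  rejoin = Eq.trans (cong (join (n (P F.zero)) (n (⨁ (P ∘ F.suc)))) (Eq.sym split≡))
                   (join-splitAt (n (P F.zero)) (n (⨁ (P ∘ F.suc))) x)
... | inj₂ y with locate (P ∘ F.suc) y
...   | i , u , ιu≡y = F.suc i , u , Eq.trans (cong (n (P F.zero) ↑ʳ_) ιu≡y) rejoin
  where
  rejoin : n (P F.zero) ↑ʳ y ≡ x
  rejoin = Eq.trans (cong (join (n (P F.zero)) (n (⨁ (P ∘ F.suc)))) (Eq.sym split≡))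
                   (join-splitAt (n (P F.zero)) (n (⨁ (P ∘ F.suc))) x)

copair-injective : ∀ {K} (P : Fin K → Graph) {X : Set} (g : ∀ i → Fin (n (P i)) → X) →
  (∀ i {u v} → g i u ≡ g i v → u ≡ v) → (∀ i j u v → g i u ≡ g j v → i ≡ j) →
  ∀ {x y} → copair P g x ≡ copair P g y → x ≡ y
copair-injective P g g-inj g-disj {x} {y} eq with locate P x | locate P y
... | i , u , refl | j , v , refl = same-component (g-disj i j u v (images i u j v eq))
  where
  images : ∀ i u j v → copair P g (ι P i u) ≡ copair P g (ι P j v) → g i u ≡ g j v
  images i u j v e = Eq.trans (Eq.sym (copair-ι P g i u)) (Eq.trans e (copair-ι P g j v))
  same-component : i ≡ j → ι P i u ≡ ι P j v
  same-component refl = cong (ι P i) (g-inj i (images i u i v eq))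

⨁-adj-within : ∀ {K} (P : Fin K → Graph) i u v → adj (⨁ P) (ι P i u) (ι P i v) ≡ adj (P i) u v
⨁-adj-within {suc K} P F.zero u v
  rewrite splitAt-↑ˡ (n (P F.zero)) u (n (⨁ (P ∘ F.suc)))
        | splitAt-↑ˡ (n (P F.zero)) v (n (⨁ (P ∘ F.suc))) = refl
⨁-adj-within {suc K} P (F.suc i) u v
  rewrite splitAt-↑ʳ (n (P F.zero)) (n (⨁ (P ∘ F.suc))) (ι (P ∘ F.suc) i u)
        | splitAt-↑ʳ (n (P F.zero)) (n (⨁ (P ∘ F.suc))) (ι (P ∘ F.suc) i v) =
  ⨁-adj-within (P ∘ F.suc) i u v

⨁-adj-across : ∀ {K} (P : Fin K → Graph) i j u v → ¬ i ≡ j → adj (⨁ P) (ι P i u) (ι P j v) ≡ false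
⨁-adj-across {suc K} P F.zero F.zero u v i≢j = ⊥-elim (i≢j refl)
⨁-adj-across {suc K} P F.zero (F.suc j) u v i≢j
  rewrite splitAt-↑ˡ (n (P F.zero)) u (n (⨁ (P ∘ F.suc)))
        | splitAt-↑ʳ (n (P F.zero)) (n (⨁ (P ∘ F.suc))) (ι (P ∘ F.suc) j v) = refl
⨁-adj-across {suc K} P (F.suc i) F.zero u v i≢j
  rewrite splitAt-↑ʳ (n (P F.zero)) (n (⨁ (P ∘ F.suc))) (ι (P ∘ F.suc) i u)
        | splitAt-↑ˡ (n (P F.zero)) v (n (⨁ (P ∘ F.suc))) = refl
⨁-adj-across {suc K} P (F.suc i) (F.suc j) u v i≢j
  rewrite splitAt-↑ʳ (n (P F.zero)) (n (⨁ (P ∘ F.suc))) (ι (P ∘ F.suc) i u)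
        | splitAt-↑ʳ (n (P F.zero)) (n (⨁ (P ∘ F.suc))) (ι (P ∘ F.suc) j v) =
  ⨁-adj-across (P ∘ F.suc) i j u v (i≢j ∘ cong F.suc)

⨁-edgeless : ∀ {K} (P : Fin K → Graph) → (∀ i → Edgeless (P i)) → Edgeless (⨁ P)
⨁-edgeless P edgeless x y with locate P x | locate P y
... | i , u , refl | j , v , refl with i ≟ j
...   | yes refl = Eq.trans (⨁-adj-within P i u v) (edgeless i u v)
...   | no i≢j   = ⨁-adj-across P i j u v i≢j

module DisjointUnionFacts {K : ℕ} {G : Graph} {H : Fin K → Graph} (D : DisjointUnion G H) where
  open DisjointUnion D

  component-⊆ : ∀ i → H i ⊆ G
  component-⊆ i = emb i , emb-inj i , emb-edge i

  adj-within : ∀ i x y → adj G (emb i x) (emb i y) ≡ adj (H i) x y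
  adj-within i x y = ≡-from-true⇔ reflect (emb-edge i x y)
    where
    reflect : adj G (emb i x) (emb i y) ≡ true → adj (H i) x y ≡ true
    reflect e with cover-E (emb i x) (emb i y) e
    ... | l , u , v , lu≡ix , lv≡iy , uv with disjoint l i u x lu≡ix
    ...   | refl with emb-inj i lu≡ix | emb-inj i lv≡iy
    ...     | refl | refl = uv

  adj-across : ∀ i j x y → ¬ i ≡ j → adj G (emb i x) (emb j y) ≡ false
  adj-across i j x y i≢j = ≢true⇒≡false λ e → no-edge (cover-E (emb i x) (emb j y) e)
    where
    no-edge : (Σ (Fin K) λ l → Σ (Fin (n (H l))) λ u → Σ (Fin (n (H l))) λ v →
                 (emb l u ≡ emb i x) × (emb l v ≡ emb j y) × (adj (H l) u v ≡ true)) → ⊥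
    no-edge (l , u , v , lu≡ix , lv≡jy , _) =
      i≢j (Eq.trans (Eq.sym (disjoint l i u x lu≡ix)) (disjoint l j v y lv≡jy))

  -- V(G) and V(⨁ H) inject into each other.
  size : n G ≡ n (⨁ H)
  size = cantor-schröder-bernstein {f = to} to-injective
           (copair-injective H emb emb-inj disjoint)
    where
    to : Fin (n G) → Fin (n (⨁ H))
    to x with cover-V x
    ... | i , u , _ = ι H i u
    from-to : ∀ x → copair H emb (to x) ≡ x
    from-to x with cover-V x
    ... | i , u , ui≡x = Eq.trans (copair-ι H emb i u) ui≡x
    to-injective : Injective to
    to-injective {x} {y} eq =
      Eq.trans (Eq.sym (from-to x)) (Eq.trans (cong (copair H emb) eq) (from-to y))

-- Removals.

module _ (T : TotalOrder 0ℓ 0ℓ 0ℓ) where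

  removal⇒⊆ : ∀ G {k} H → RemovalOf T G k H → H ⊆ G
  removal⇒⊆ G H (_ , f , f-inj , f-adj) = f , f-inj , λ u v e → Eq.trans (Eq.sym (f-adj u v)) e

  removal-none : ∀ G → RemovalOf T G 0 G
  removal-none G = ℕP.+-identityʳ (n G) , (λ x → x) , (λ e → e) , λ _ _ → refl

  assemble : ∀ {K G} {H : Fin K → Graph} → DisjointUnion G H →
             (P : Fin K → Graph) (r : Fin K → ℕ) → (∀ k → RemovalOf T (H k) (r k) (P k)) →
             RemovalOf T G (∑ r) (⨁ P)
  assemble {G = G} {H = H} D P r R = size-ok , copair P g , g-injective , g-induced
    where
    open DisjointUnion D
    open DisjointUnionFacts D

    f : ∀ k → Fin (n (P k)) → Fin (n (H k))
    f k = proj₁ (proj₂ (R k))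

    g : ∀ k → Fin (n (P k)) → Fin (n G)
    g k u = emb k (f k u)

    size-ok : n (⨁ P) + ∑ r ≡ n G
    size-ok = begin
      n (⨁ P) + ∑ r                ≡⟨ cong (_+ ∑ r) (⨁-size P) ⟩
      ∑ (sizes P) + ∑ r            ≡⟨ Eq.sym (∑-+ (sizes P) r) ⟩
      ∑ (λ k → n (P k) + r k)      ≡⟨ ∑-cong (proj₁ ∘ R) ⟩
      ∑ (sizes H)                  ≡⟨ Eq.sym (⨁-size H) ⟩
      n (⨁ H)                      ≡⟨ Eq.sym size ⟩
      n G                          ∎
      where open Eq.≡-Reasoning

    g-injective : Injective (copair P g)
    g-injective = copair-injective P g
      (λ k e → proj₁ (proj₂ (proj₂ (R k))) (emb-inj k e))
      (λ i j u v e → disjoint i j (f i u) (f j v) e)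

    g-induced : ∀ x y → adj (⨁ P) x y ≡ adj G (copair P g x) (copair P g y)
    g-induced x y with locate P x | locate P y
    ... | i , u , refl | j , v , refl rewrite copair-ι P g i u | copair-ι P g j v with i ≟ j
    ...   | yes refl = Eq.trans (⨁-adj-within P i u v)
                         (Eq.trans (proj₂ (proj₂ (proj₂ (R i))) u v) (Eq.sym (adj-within i (f i u) (f i v))))
    ...   | no i≢j   = Eq.trans (⨁-adj-across P i j u v i≢j) (Eq.sym (adj-across i j (f i u) (f j v) i≢j))

  -- Conversely, an induced embedding f : H' → G of a removal restricts to
  -- every component: Q i is the subgraph of H i induced by the vertices hit
  -- by f.
  module Restriction {K G} {H : Fin K → Graph} (D : DisjointUnion G H) (H' : Graph)
                     (f : Fin (n H') → Fin (n G)) (f-inj : Injective f)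
                     (f-induced : ∀ u v → adj H' u v ≡ adj G (f u) (f v)) where
    open DisjointUnion D
    open DisjointUnionFacts D

    hit : ∀ i → Fin (n (H i)) → Bool
    hit i u = does (any? (λ w → f w ≟ emb i u))

    preimage : ∀ i u → hit i u ≡ true → Σ (Fin (n H')) λ w → f w ≡ emb i u
    preimage i u _ with any? (λ w → f w ≟ emb i u)
    preimage i u _  | yes found = found
    preimage i u () | no _

    is-hit : ∀ i u w → f w ≡ emb i u → hit i u ≡ true
    is-hit i u w fw≡ with any? (λ w → f w ≟ emb i u)
    ... | yes _    = refl
    ... | no ¬any = ⊥-elim (¬any (w , fw≡))

    Q : Fin K → Graph
    Q i = Induced (H i) (hit i)

    r : Fin K → ℕ
    r i = n (H i) ∸ n (Q i)

    Q-removal : ∀ i → RemovalOf T (H i) (r i) (Q i)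
    Q-removal i = ℕP.m+[n∸m]≡n (count-≤ (hit i)) , enum (hit i) , enum-injective (hit i) , λ _ _ → refl

    pull : ∀ i → Fin (n (Q i)) → Fin (n H')
    pull i u = proj₁ (preimage i (enum (hit i) u) (enum-selected (hit i) u))

    pull-over : ∀ i u → f (pull i u) ≡ emb i (enum (hit i) u)
    pull-over i u = proj₂ (preimage i (enum (hit i) u) (enum-selected (hit i) u))

    Q⊆H' : ∀ i → Q i ⊆ H'
    Q⊆H' i = pull i , pull-injective , pull-edge
      where
      pull-injective : Injective (pull i)
      pull-injective {u} {v} e = enum-injective (hit i)
        (emb-inj i (Eq.trans (Eq.sym (pull-over i u)) (Eq.trans (cong f e) (pull-over i v))))
      pull-edge : ∀ u v → adj (Q i) u v ≡ true → adj H' (pull i u) (pull i v) ≡ true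
      pull-edge u v e = Eq.trans (f-induced (pull i u) (pull i v))
        (Eq.trans (cong₂ (adj G) (pull-over i u) (pull-over i v)) (emb-edge i _ _ e))

    -- Every vertex of H' sits in some Q i, so |H'| ≤ |⨁ Q|.
    H'-size : n H' ≤ n (⨁ Q)
    H'-size = injective⇒≤ {f = push} push-injective
      where
      over : ∀ i → Fin (n (Q i)) → Fin (n G)
      over i u = emb i (enum (hit i) u)
      push : Fin (n H') → Fin (n (⨁ Q))
      push w with cover-V (f w)
      ... | i , u , iu≡fw = ι Q i (proj₁ (enum-surjective (hit i) u (is-hit i u w (Eq.sym iu≡fw))))
      push-over : ∀ w → copair Q over (push w) ≡ f w
      push-over w with cover-V (f w)
      ... | i , u , iu≡fw with enum-surjective (hit i) u (is-hit i u w (Eq.sym iu≡fw))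
      ...   | u' , u'≡u = Eq.trans (copair-ι Q over i u') (Eq.trans (cong (emb i) u'≡u) iu≡fw)
      push-injective : Injective push
      push-injective {w} {w'} e =
        f-inj (Eq.trans (Eq.sym (push-over w)) (Eq.trans (cong (copair Q over) e) (push-over w')))

    ∑r≤ : ∀ k → n H' + k ≡ n G → ∑ r ≤ k
    ∑r≤ k size-ok = ℕP.+-cancelʳ-≤ (n (⨁ Q)) (∑ r) k chain
      where
      open ℕP.≤-Reasoning
      chain : ∑ r + n (⨁ Q) ≤ k + n (⨁ Q)
      chain = begin
        ∑ r + n (⨁ Q)              ≡⟨ cong (∑ r +_) (⨁-size Q) ⟩
        ∑ r + ∑ (sizes Q)          ≡⟨ Eq.sym (∑-+ r (sizes Q)) ⟩
        ∑ (λ i → r i + n (Q i))    ≡⟨ ∑-cong (λ i → ℕP.m∸n+n≡m (count-≤ (hit i))) ⟩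
        ∑ (sizes H)                ≡⟨ Eq.sym (⨁-size H) ⟩
        n (⨁ H)                    ≡⟨ Eq.sym size ⟩
        n G                        ≡⟨ Eq.sym size-ok ⟩
        n H' + k                   ≤⟨ ℕP.+-monoˡ-≤ k H'-size ⟩
        n (⨁ Q) + k                ≡⟨ ℕP.+-comm (n (⨁ Q)) k ⟩
        k + n (⨁ Q)                ∎

  module _ (ρ : Graph → TotalOrder.Carrier T) (maxing : Maxing T ρ) (mono : MonotoneIncreasing T ρ) where
    open TotalOrder T using (_≈_; total; antisym) renaming (_≤_ to _≼_; trans to ≼-trans)
    module ≈ = TotalOrder.Eq T

    ≈-≼ : ∀ {x y z} → x ≈ y → y ≼ z → x ≼ z
    ≈-≼ x≈y y≼z = ≼-trans (TotalOrder.reflexive T x≈y) y≼z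

    ⊕-bounded : ∀ A B {c} → ρ A ≼ c → ρ B ≼ c → ρ (A ⊕ B) ≼ c
    ⊕-bounded A B A≼c B≼c with total (ρ A) (ρ B)
    ... | inj₁ A≼B = ≈-≼ (proj₂ (maxing A B) A≼B) B≼c
    ... | inj₂ B≼A = ≈-≼ (proj₁ (maxing A B) B≼A) A≼c

    -- ρ of an edgeless graph lies below ρ of any graph with a vertex: the
    -- graph Discrete k is a union of k single vertices, each of which
    -- embeds into Y.
    discrete-below : ∀ {Y} → Fin (n Y) → ∀ k → ρ (Discrete k) ≼ ρ Y
    discrete-below {Y} y zero    = mono (Discrete 0) Y ((λ ()) , (λ { {()} }) , λ ())
    discrete-below {Y} y (suc k) =
      ≼-trans (mono _ _ ((λ x → x) , (λ e → e) , λ _ _ ()))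
              (⊕-bounded (Discrete 1) (Discrete k) single-below (discrete-below y k))
      where
      single-below : ρ (Discrete 1) ≼ ρ Y
      single-below = mono (Discrete 1) Y ((λ _ → y) , (λ { {F.zero} {F.zero} _ → refl }) , λ _ _ ())

    edgeless-below : ∀ {X Y} → Edgeless X → Fin (n Y) → ρ X ≼ ρ Y
    edgeless-below {X} X-edgeless y =
      ≼-trans (mono X (Discrete (n X)) ((λ x → x) , (λ e → e) , λ u v e → ⊥-elim (true≢false e (X-edgeless u v))))
              (discrete-below y (n X))

    ⨁-attained : ∀ {K} (P : Fin K → Graph) →
                 (Σ (Fin K) λ i → ρ (⨁ P) ≈ ρ (P i)) ⊎ (ρ (⨁ P) ≈ ρ (Discrete 0))
    ⨁-attained {zero}  P = inj₂ ≈.refl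
    ⨁-attained {suc K} P with total (ρ (P F.zero)) (ρ (⨁ (P ∘ F.suc)))
    ... | inj₂ rest≼head = inj₁ (F.zero , proj₁ (maxing _ _) rest≼head)
    ... | inj₁ head≼rest with ⨁-attained (P ∘ F.suc)
    ...   | inj₁ (i , e) = inj₁ (F.suc i , ≈.trans (proj₂ (maxing _ _) head≼rest) e)
    ...   | inj₂ e       = inj₂ (≈.trans (proj₂ (maxing _ _) head≼rest) e)

    -- Otherwise the value c would be attained by a
    -- piece that must be edgeless, hence below a non-edgeless piece k, which
    -- would then itself have value c.
    ⨁-destroys : ∀ {K} (P : Fin K → Graph) c → (∀ k → ρ (P k) ≼ c) →
                 (∀ k → (¬ ρ (P k) ≈ c) ⊎ Edgeless (P k)) →
                 (¬ ρ (⨁ P) ≈ c) ⊎ Edgeless (⨁ P)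
    ⨁-destroys {K} P c below destroyed with all? (λ k → edgeless? (P k))
    ... | yes all-edgeless = inj₂ (⨁-edgeless P all-edgeless)
    ... | no ¬all-edgeless with ¬∀⟶∃¬ K _ (λ k → edgeless? (P k)) ¬all-edgeless
    ...   | k , ¬edgeless = inj₁ (reaches-c ∘ attained-at-c (⨁-attained P))
      where
      k≉c : ¬ ρ (P k) ≈ c
      k≉c = [ (λ ≉c → ≉c) , (λ el → ⊥-elim (¬edgeless el)) ]′ (destroyed k)

      -- An edgeless graph of value c forces ρ (P k) ≈ c.
      reaches-c : Σ Graph (λ X → Edgeless X × ρ X ≈ c) → ⊥
      reaches-c (X , X-edgeless , X≈c) =
        k≉c (antisym (below k) (≈-≼ (≈.sym X≈c) (edgeless-below X-edgeless (vertex-of (P k) ¬edgeless))))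

      attained-at-c : (Σ (Fin K) λ i → ρ (⨁ P) ≈ ρ (P i)) ⊎ (ρ (⨁ P) ≈ ρ (Discrete 0)) →
                      ρ (⨁ P) ≈ c → Σ Graph (λ X → Edgeless X × ρ X ≈ c)
      attained-at-c (inj₂ e) ⨁≈c = Discrete 0 , (λ _ _ → refl) , ≈.trans (≈.sym e) ⨁≈c
      attained-at-c (inj₁ (i , e)) ⨁≈c with destroyed i
      ... | inj₁ i≉c      = ⊥-elim (i≉c (≈.trans (≈.sym e) ⨁≈c))
      ... | inj₂ edgeless = P i , edgeless , ≈.trans (≈.sym e) ⨁≈c

    -- A destroying subgraph H' of G restricts to a destroying subgraph of
    -- any component X with ρ X ≈ ρ G: if Q ⊆ H' ⊆ G kept the value, then
    -- ρ G ≈ ρ Q ≼ ρ H' ≼ ρ G.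
    lift-destroy : ∀ {Q H' G X} → Q ⊆ H' → H' ⊆ G → ρ X ≈ ρ G →
                   (¬ ρ H' ≈ ρ G) ⊎ Edgeless H' → (¬ ρ Q ≈ ρ X) ⊎ Edgeless Q
    lift-destroy {Q} {H'} {G} Q⊆H' H'⊆G X≈G (inj₁ H'≉G) =
      inj₁ λ Q≈X → H'≉G (antisym (mono H' G H'⊆G) (≈-≼ (≈.sym (≈.trans Q≈X X≈G)) (mono Q H' Q⊆H')))
    lift-destroy {Q} {H'} Q⊆H' H'⊆G X≈G (inj₂ H'-edgeless) = inj₂ (⊆-edgeless {Q} {H'} Q⊆H' H'-edgeless)

    module _ (s t : ℕ) (G : Graph) (H : Fin (s + t) → Graph) (D : DisjointUnion G H)
             (full : ∀ (i : Fin s) → ρ (H (i ↑ˡ t)) ≈ ρ G)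
             (deficient : ∀ (j : Fin t) → ¬ ρ (H (s ↑ʳ j)) ≈ ρ G)
             (m : Fin s → ℕ) (vs : ∀ (i : Fin s) → IsVS T ρ (H (i ↑ˡ t)) (m i)) where
      open DisjointUnionFacts D using (component-⊆)

      upper-bound : Destroys T ρ G (∑ m)
      upper-bound = ⨁ P , subst (λ k → RemovalOf T G k (⨁ P)) ∑cost≡∑m (assemble D P cost (proj₁ ∘ proj₂ ∘ piece))
                  , ⨁-destroys P (ρ G) P-below (proj₂ ∘ proj₂ ∘ piece)
        where
        cost : Fin (s + t) → ℕ
        cost k = [ m , (λ _ → 0) ]′ (splitAt s k)

        Piece : Fin (s + t) → Set
        Piece k = Σ Graph λ P → RemovalOf T (H k) (cost k) P × ((¬ ρ P ≈ ρ G) ⊎ Edgeless P)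

        piece : ∀ k → Piece k
        piece k with side s t k
        ... | left i rewrite splitAt-↑ˡ s i t with proj₁ (vs i)
        ...   | P , removal , inj₁ P≉H = P , removal , inj₁ (λ P≈G → P≉H (≈.trans P≈G (≈.sym (full i))))
        ...   | P , removal , inj₂ edgeless = P , removal , inj₂ edgeless
        piece k | right j rewrite splitAt-↑ʳ s t j = H k , removal-none (H k) , inj₁ (deficient j)

        P : Fin (s + t) → Graph
        P k = proj₁ (piece k)

        P-below : ∀ k → ρ (P k) ≼ ρ G
        P-below k = ≼-trans (mono (P k) (H k) (removal⇒⊆ (H k) (P k) (proj₁ (proj₂ (piece k)))))
                            (mono (H k) G (component-⊆ k))

        ∑cost≡∑m : ∑ cost ≡ ∑ m
        ∑cost≡∑m = begin
          ∑ cost                                               ≡⟨ ∑-split s t cost ⟩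
          ∑ (λ i → cost (i ↑ˡ t)) + ∑ (λ j → cost (s ↑ʳ j))   ≡⟨ cong₂ _+_ (∑-cong (λ i → cong [ m , (λ _ → 0) ]′ (splitAt-↑ˡ s i t)))
                                                                            (∑-cong (λ j → cong [ m , (λ _ → 0) ]′ (splitAt-↑ʳ s t j))) ⟩
          ∑ m + ∑ {t} (λ _ → 0)                                ≡⟨ cong (∑ m +_) (∑-zero t) ⟩
          ∑ m + 0                                              ≡⟨ ℕP.+-identityʳ (∑ m) ⟩
          ∑ m                                                  ∎
          where open Eq.≡-Reasoning

      lower-bound : ∀ k → Destroys T ρ G k → ∑ m ≤ k
      lower-bound k (H' , removal@(size-ok , f , f-inj , f-induced) , destroyed) = begin
        ∑ m                                                 ≤⟨ ∑-mono m≤r ⟩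
        ∑ (λ i → r (i ↑ˡ t))                                ≤⟨ ℕP.m≤m+n _ _ ⟩
        ∑ (λ i → r (i ↑ˡ t)) + ∑ (λ j → r (s ↑ʳ j))        ≡⟨ Eq.sym (∑-split s t r) ⟩
        ∑ r                                                 ≤⟨ ∑r≤ k size-ok ⟩
        k                                                   ∎
        where
        open ℕP.≤-Reasoning
        open Restriction D H' f f-inj f-induced
        m≤r : ∀ i → m i ≤ r (i ↑ˡ t)
        m≤r i = proj₂ (vs i) _ (Q (i ↑ˡ t) , Q-removal (i ↑ˡ t)
                               , lift-destroy (Q⊆H' (i ↑ˡ t)) (removal⇒⊆ G H' removal) (full i) destroyed)

mainTheorem1 : (T : TotalOrder 0ℓ 0ℓ 0ℓ) → (ρ : Graph → TotalOrder.Carrier T) →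
    Maxing T ρ → MonotoneIncreasing T ρ →
    (s t : ℕ) → 1 ≤ s →
    (G : Graph) (H : Fin (s + t) → Graph) → DisjointUnion G H →
    (∀ (i : Fin s) → TotalOrder._≈_ T (ρ (H (i ↑ˡ t))) (ρ G)) →
    (∀ (j : Fin t) → ¬ TotalOrder._≈_ T (ρ (H (s ↑ʳ j))) (ρ G)) →
    (m : Fin s → ℕ) → (∀ (i : Fin s) → IsVS T ρ (H (i ↑ˡ t)) (m i)) →
    IsVS T ρ G (∑ m)
mainTheorem1 T ρ maxing mono s t _ G H D full deficient m vs =
  upper-bound T ρ maxing mono s t G H D full deficient m vs ,
  lower-bound T ρ maxing mono s t G H D full deficient m vs
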